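{- Let $a, b, c$ be nonzero integers such that $-ab$ is not a perfect square and $\gcd(a,b,c)=1$, and let $X, Y \in M_2(\mathbb{Z})$. Then $aX^2 + bY^2 = cI$ and $XY = YX$ if and only if one of the following holds: (i) $X = t_1 I$ and $Y = t_2 I$, where $t_1, t_2 \in \mathbb{Z}$ satisfy $a t_1^2 + b t_2^2 = c$; (ii) $X = t_1 I$ and $Y = \begin{pmatrix} t_4 & t_2 \\ t_3 & -t_4 \end{pmatrix}$, where $t_1, t_2, t_3, t_4 \in \mathbb{Z}$ satisfy $a t_1^2 + b(t_4^2 + t_2 t_3) = c$; (iii) $X = t_1 I + \frac{u-c}{g}\begin{pmatrix} 0 & t_2 \\ t_3 & -k \end{pmatrix}$ and $Y = t_4 I + \frac{va}{g}\begin{pmatrix} 0 & t_2 \\ t_3 & -k \end{pmatrix}$, where $t_1, t_2, t_3, t_4, u, v, k \in \mathbb{Z}$, $u \neq c$, $g = \gcd(va, u-c)$, and $$u^2 + v^2 ab = c^2, \qquad a t_1^2 + b t_4^2 + \frac{2ac\, t_2 t_3}{g^2}(c-u) = c, \qquad (g t_1 + ck)(u-c) + vbg\, t_4 = 0.$$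
   Context: $M_2(\mathbb{Z})$ denotes the ring of $2\times 2$ matrices with integer entries; $I$ is the $2\times 2$ identity matrix. -}

module Defs where

open import Data.Nat using (suc)
open import Data.Integer using (ℤ; +_; -[1+_]; _+_; _*_; -_; _-_; _/_)
open import Data.Product using (∃)
open import Relation.Binary.PropositionalEquality using (_≡_)
open import Relation.Nullary using (¬_)

record M2 : Set where
  constructor mat
  field
    m11 m12 m21 m22 : ℤ

open M2 public

_⊕_ : M2 → M2 → M2
mat a b c d ⊕ mat a' b' c' d' = mat (a + a') (b + b') (c + c') (d + d')

_⊗_ : M2 → M2 → M2
mat a b c d ⊗ mat a' b' c' d' =
  mat (a * a' + b * c') (a * b' + b * d') (c * a' + d * c') (c * b' + d * d')

_·_ : ℤ → M2 → M2
s · mat a b c d = mat (s * a) (s * b) (s * c) (s * d)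

I : M2
I = mat (+ 1) (+ 0) (+ 0) (+ 1)

_² : M2 → M2
X ² = X ⊗ X

-- integer division; only used when the divisor is nonzero and divides the
-- dividend (exact quotient). The value at divisor 0 is an irrelevant default.
_÷_ : ℤ → ℤ → ℤ
x ÷ (+ 0) = + 0
x ÷ d@(+ suc n) = x / d
x ÷ d@(-[1+ n ]) = x / d

IsPerfectSquare : ℤ → Set
IsPerfectSquare z = ∃ λ n → n * n ≡ z

{-# OPTIONS --safe #-}
module Submission where

-- Two 2×2 matrices commute iff their parts (x₁₂, x₂₁, x₂₂ − x₁₁) off the scalars are parallel, so
-- commuting integer X and Y lie in a common pencil: X = t₁ I + d N and Y = t₄ I + e N with (d, e)
-- coprime and N = (0 n₁ / n₂ n₃). Since N² = n₃ N + n₁ n₂ I, the equation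
-- a X² + b Y² = c I becomes α I + β N = c I, i.e. α = c and β N = 0. If N = 0 both matrices are
-- scalar (i); if X is scalar, β = 0 says that Y is traceless (ii). Otherwise d ≠ 0, and
-- s = a d² + b e² ≠ 0 because −ab is not a square. Then (u, v) with u − c = −2acd²/s and
-- v = −2cde/s is an integral point of the conic u² + ab v² = c² on the line through (c, 0) of
-- direction (ad, e); as (d, e) is primitive, (u − c, va) = μ (d, e) with μ = ±gcd (va, u − c),
-- and α = c, β = 0 become the two equations of (iii).

open import Defs
open import Data.Integer using (ℤ; +_; -[1+_]; 0ℤ; 1ℤ; _+_; _*_; -_; _-_; ∣_∣; NonZero)
open import Data.Integer.Base using (≢-nonZero)
open import Data.Integer.Coprimality using (Coprime; coprime-divisor)
open import Data.Integer.DivMod using (_/_; _%_; a≡a%n+[a/n]*n; n%d<d)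
open import Data.Integer.Divisibility.Signed
  using (_∣_; divides; ∣ᵤ⇒∣; ∣⇒∣ᵤ; ∣-refl; ∣n⇒∣m*n; ∣m+n∣n⇒∣m; *-monoʳ-∣)
open import Data.Integer.GCD using (gcd; gcd[i,j]∣i; gcd[i,j]∣j; gcd[i,j]≡0⇒i≡0; gcd[i,j]≡0⇒j≡0)
open import Data.Integer.Properties
  using (_≟_; *-comm; *-zeroˡ; *-zeroʳ; *-identityˡ; +-identityˡ; *-cancelˡ-≡; i*j≡0⇒i≡0∨j≡0;
         i-j≡0⇒i≡j; i≡j⇒i-j≡0; neg-involutive; abs-*; ∣i∣≡0⇒i≡0; ∣-i∣≡∣i∣)
open import Data.Integer.Tactic.RingSolver using (solve)
import Data.Nat as ℕ
import Data.Nat.Properties as ℕ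
open import Data.Nat.Coprimality
  using (GCD≡1⇒coprime; coprime⇒gcd≡1; 0-coprimeTo-m⇒m≡1; 1-coprimeTo)
  renaming (Coprime to Coprimeℕ; sym to coprime-sym)
open import Data.Nat.Divisibility using (>⇒∤) renaming (_∣_ to _∣ℕ_)
open import Data.Nat.GCD using (GCD; gcd-GCD; GCD-*; c*gcd[m,n]≡gcd[cm,cn]) renaming (gcd to gcdℕ)
open import Data.Empty using (⊥-elim)
open import Data.List using (List; []; _∷_)
open import Data.Product using (∃; ∃₂; _×_; _,_)
open import Data.Sum using (_⊎_; inj₁; inj₂; [_,_]′)
open import Function.Bundles using (_⇔_; mk⇔)
open import Relation.Binary.PropositionalEquality
  using (_≡_; _≢_; refl; sym; trans; cong; cong₂; subst; subst₂; module ≡-Reasoning)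
open import Relation.Nullary using (¬_; Dec; yes; no; contradiction)

*-cancelˡ-≢0 : ∀ {i j k} → i ≢ 0ℤ → i * j ≡ i * k → j ≡ k
*-cancelˡ-≢0 {i} {j} {k} i≢0 = *-cancelˡ-≡ i j k {{≢-nonZero i≢0}}

*-≢0 : ∀ {i j} → i ≢ 0ℤ → j ≢ 0ℤ → i * j ≢ 0ℤ
*-≢0 {i} i≢0 j≢0 ij≡0 = [ i≢0 , j≢0 ]′ (i*j≡0⇒i≡0∨j≡0 i ij≡0)

-- An equation L ≡ R follows from equations lₖ ≡ rₖ once L − R is exhibited as a combination
-- Σ pₖ (lₖ − rₖ); that certificate is a polynomial identity, checked by the ring solver.

combination₁ : ∀ {L R l₁ r₁} p₁ → l₁ ≡ r₁ → L - R ≡ p₁ * (l₁ - r₁) → L ≡ R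
combination₁ {L} {R} {l₁} p₁ refl eq = i-j≡0⇒i≡j L R (trans eq (solve (p₁ ∷ l₁ ∷ [])))

combination₂ : ∀ {L R l₁ r₁ l₂ r₂} p₁ p₂ → l₁ ≡ r₁ → l₂ ≡ r₂ →
  L - R ≡ p₁ * (l₁ - r₁) + p₂ * (l₂ - r₂) → L ≡ R
combination₂ {L} {R} {l₁} {_} {l₂} p₁ p₂ refl refl eq =
  i-j≡0⇒i≡j L R (trans eq (solve (p₁ ∷ l₁ ∷ p₂ ∷ l₂ ∷ [])))

combination₃ : ∀ {L R l₁ r₁ l₂ r₂ l₃ r₃} p₁ p₂ p₃ → l₁ ≡ r₁ → l₂ ≡ r₂ → l₃ ≡ r₃ →
  L - R ≡ p₁ * (l₁ - r₁) + p₂ * (l₂ - r₂) + p₃ * (l₃ - r₃) → L ≡ R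
combination₃ {L} {R} {l₁} {_} {l₂} {_} {l₃} p₁ p₂ p₃ refl refl refl eq =
  i-j≡0⇒i≡j L R (trans eq (solve (p₁ ∷ l₁ ∷ p₂ ∷ l₂ ∷ p₃ ∷ l₃ ∷ [])))

combination₄ : ∀ {L R l₁ r₁ l₂ r₂ l₃ r₃ l₄ r₄} p₁ p₂ p₃ p₄ →
  l₁ ≡ r₁ → l₂ ≡ r₂ → l₃ ≡ r₃ → l₄ ≡ r₄ →
  L - R ≡ p₁ * (l₁ - r₁) + p₂ * (l₂ - r₂) + p₃ * (l₃ - r₃) + p₄ * (l₄ - r₄) → L ≡ R
combination₄ {L} {R} {l₁} {_} {l₂} {_} {l₃} {_} {l₄} p₁ p₂ p₃ p₄ refl refl refl refl eq =
  i-j≡0⇒i≡j L R (trans eq (solve (p₁ ∷ l₁ ∷ p₂ ∷ l₂ ∷ p₃ ∷ l₃ ∷ p₄ ∷ l₄ ∷ [])))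

∣∧<⇒≡0 : ∀ {m n} → n ∣ℕ m → m ℕ.< n → m ≡ 0
∣∧<⇒≡0 {ℕ.zero} _ _ = refl
∣∧<⇒≡0 {ℕ.suc _} n∣m m<n = contradiction n∣m (>⇒∤ m<n)

/-exact : ∀ {g x} .{{_ : NonZero g}} → g ∣ x → g * (x / g) ≡ x
/-exact {g} {x} g∣x = begin
  g * (x / g)              ≡⟨ *-comm g (x / g) ⟩
  (x / g) * g              ≡⟨ sym (+-identityˡ _) ⟩
  + 0 + (x / g) * g        ≡⟨ cong (λ r → + r + (x / g) * g) (sym remainder≡0) ⟩
  + (x % g) + (x / g) * g  ≡⟨ sym (a≡a%n+[a/n]*n x g) ⟩
  x                        ∎
  where
  open ≡-Reasoning
  g∣remainder : g ∣ + (x % g)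
  g∣remainder = ∣m+n∣n⇒∣m (subst (g ∣_) (a≡a%n+[a/n]*n x g) g∣x) (∣n⇒∣m*n (x / g) ∣-refl)
  remainder≡0 : x % g ≡ 0
  remainder≡0 = ∣∧<⇒≡0 (∣⇒∣ᵤ g∣remainder) (n%d<d x g)

÷-exact : ∀ {g x} → g ≢ 0ℤ → g ∣ x → g * (x ÷ g) ≡ x
÷-exact {+ ℕ.zero} g≢0 _ = ⊥-elim (g≢0 refl)
÷-exact {+ ℕ.suc _} _ g∣x = /-exact g∣x
÷-exact { -[1+ _ ]} _ g∣x = /-exact g∣x

*÷-cancel : ∀ {g q} → g ≢ 0ℤ → (g * q) ÷ g ≡ q
*÷-cancel {g} {q} g≢0 = *-cancelˡ-≢0 g≢0 (÷-exact g≢0 (divides q (*-comm g q)))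

-- Parallel vectors and primitive directions

infix 4 _∥_

data _∥_ : ℤ × ℤ → ℤ × ℤ → Set where
  cross : ∀ {m l m′ l′} → m′ * l ≡ l′ * m → (m , l) ∥ (m′ , l′)

∥-refl : ∀ {m l} → (m , l) ∥ (m , l)
∥-refl {m} {l} = cross (*-comm m l)

∥-sym : ∀ {m l m′ l′} → (m , l) ∥ (m′ , l′) → (m′ , l′) ∥ (m , l)
∥-sym {m} {l} {m′} {l′} (cross m′l≡l′m) =
  cross (trans (*-comm m l′) (trans (sym m′l≡l′m) (*-comm m′ l)))

primitive-decomposition : ∀ {m l} → m ≢ 0ℤ →
  ∃₂ λ d e → ∃ λ G → G ≢ 0ℤ × Coprime d e × m ≡ d * G × l ≡ e * G
primitive-decomposition {m} {l} m≢0 = d , e , G , G≢0 , d⊥e , m≡dG , l≡eG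
  where
  G : ℤ
  G = gcd m l
  G∣m : G ∣ m
  G∣m = ∣ᵤ⇒∣ (gcd[i,j]∣i m l)
  G∣l : G ∣ l
  G∣l = ∣ᵤ⇒∣ (gcd[i,j]∣j m l)
  d e : ℤ
  d = _∣_.quotient G∣m
  e = _∣_.quotient G∣l
  m≡dG : m ≡ d * G
  m≡dG = _∣_.equality G∣m
  l≡eG : l ≡ e * G
  l≡eG = _∣_.equality G∣l
  G≢0 : G ≢ 0ℤ
  G≢0 G≡0 = m≢0 (gcd[i,j]≡0⇒i≡0 m l G≡0)
  instance
    ∣G∣≢0 : ℕ.NonZero ∣ G ∣
    ∣G∣≢0 = ℕ.≢-nonZero (λ ∣G∣≡0 → G≢0 (∣i∣≡0⇒i≡0 ∣G∣≡0))
  d⊥e : Coprime d e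
  d⊥e = GCD≡1⇒coprime (GCD-* {c = ∣ G ∣} (subst₂ (λ i j → GCD i j (1 ℕ.* ∣ G ∣))
    (trans (cong ∣_∣ m≡dG) (abs-* d G)) (trans (cong ∣_∣ l≡eG) (abs-* e G))
    (subst (GCD ∣ m ∣ ∣ l ∣) (sym (ℕ.*-identityˡ _)) (gcd-GCD ∣ m ∣ ∣ l ∣))))

∥-cancel : ∀ {G m l m′ l′} d e → G ≢ 0ℤ → m ≡ d * G → l ≡ e * G →
  (m , l) ∥ (m′ , l′) → (d , e) ∥ (m′ , l′)
∥-cancel {G} {m} {l} {m′} {l′} d e G≢0 m≡dG l≡eG (cross m′l≡l′m) = cross
  (*-cancelˡ-≢0 G≢0 (combination₃ (+ 1) (- m′) l′ m′l≡l′m l≡eG m≡dG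
    (solve (G ∷ e ∷ m′ ∷ l′ ∷ d ∷ l ∷ m ∷ []))))

∥-coprime⇒multiple : ∀ {d e m′ l′} → d ≢ 0ℤ → Coprime d e →
  (d , e) ∥ (m′ , l′) → ∃ λ n → m′ ≡ d * n × l′ ≡ e * n
∥-coprime⇒multiple {d} {e} {m′} {l′} d≢0 d⊥e (cross m′e≡l′d) =
  multiple (∣ᵤ⇒∣ (coprime-divisor d e m′ d⊥e (∣⇒∣ᵤ (divides l′ (trans (*-comm e m′) m′e≡l′d)))))
  where
  multiple : d ∣ m′ → ∃ λ n → m′ ≡ d * n × l′ ≡ e * n
  multiple (divides n m′≡nd) = n , trans m′≡nd (*-comm n d) ,
    *-cancelˡ-≢0 d≢0 (combination₂ (- + 1) e m′e≡l′d m′≡nd (solve (d ∷ l′ ∷ e ∷ n ∷ m′ ∷ [])))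

gcd[m*i,m*j]≡m : ∀ m i j → Coprime i j → gcd (+ m * i) (+ m * j) ≡ + m
gcd[m*i,m*j]≡m m i j i⊥j = begin
  gcd (+ m * i) (+ m * j)             ≡⟨ cong₂ (λ x y → + gcdℕ x y) (abs-* (+ m) i) (abs-* (+ m) j) ⟩
  + gcdℕ (m ℕ.* ∣ i ∣) (m ℕ.* ∣ j ∣)  ≡⟨ cong +_ (sym (c*gcd[m,n]≡gcd[cm,cn] m ∣ i ∣ ∣ j ∣)) ⟩
  + (m ℕ.* gcdℕ ∣ i ∣ ∣ j ∣)          ≡⟨ cong (λ g → + (m ℕ.* g)) (coprime⇒gcd≡1 i⊥j) ⟩
  + (m ℕ.* 1)                         ≡⟨ cong +_ (ℕ.*-identityʳ m) ⟩
  + m                                 ∎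
  where open ≡-Reasoning

-- The binary form a d² + b e²

coprime-∣-square : ∀ {d e x} → Coprime d e → e ∣ d * (d * x) → e ∣ x
coprime-∣-square {d} {e} {x} d⊥e e∣ddx = ∣ᵤ⇒∣
  (coprime-divisor e d x e⊥d (coprime-divisor e d (d * x) e⊥d (∣⇒∣ᵤ e∣ddx)))
  where
  e⊥d : Coprime e d
  e⊥d = coprime-sym d⊥e

e²∣a : ∀ {a b d e} → e ≢ 0ℤ → Coprime d e → a * d * d + b * e * e ≡ 0ℤ → e * e ∣ a
e²∣a {a} {b} {d} {e} e≢0 d⊥e q≡0 =
  from-e∣a (coprime-∣-square {d} {e} {a} d⊥e (divides (- (b * e)) dda≡-bee))
  where
  dda≡-bee : d * (d * a) ≡ - (b * e) * e
  dda≡-bee = combination₁ (+ 1) q≡0 (solve (a ∷ b ∷ d ∷ e ∷ []))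
  from-e∣a : e ∣ a → e * e ∣ a
  from-e∣a (divides a₁ a≡a₁e) = subst (e * e ∣_) (trans (*-comm e a₁) (sym a≡a₁e))
    (*-monoʳ-∣ e (coprime-∣-square {d} {e} {a₁} d⊥e (divides (- b) dda₁≡-be)))
    where
    dda₁≡-be : d * (d * a₁) ≡ - b * e
    dda₁≡-be = *-cancelˡ-≢0 e≢0 (combination₂ (+ 1) (- (d * d)) q≡0 a≡a₁e
      (solve (a ∷ a₁ ∷ b ∷ d ∷ e ∷ [])))

quadratic-form≡0⇒square : ∀ {a b d e} → a ≢ 0ℤ → d ≢ 0ℤ → Coprime d e →
  a * d * d + b * e * e ≡ 0ℤ → IsPerfectSquare (- (a * b))
quadratic-form≡0⇒square {a} {b} {d} {e} a≢0 d≢0 d⊥e q≡0 = by-cases (e ≟ 0ℤ)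
  where
  by-cases : Dec (e ≡ 0ℤ) → IsPerfectSquare (- (a * b))
  by-cases (yes refl) =
    ⊥-elim (*-≢0 a≢0 (*-≢0 d≢0 d≢0) (combination₁ (+ 1) q≡0 (solve (a ∷ b ∷ d ∷ []))))
  by-cases (no e≢0) = witness (e²∣a {a} {b} {d} {e} e≢0 d⊥e q≡0)
    where
    witness : e * e ∣ a → IsPerfectSquare (- (a * b))
    witness (divides a₂ a≡a₂ee) = a₂ * e * d , combination₂ b (a₂ * e * e) a≡a₂ee b≡-a₂dd
      (solve (a ∷ a₂ ∷ b ∷ d ∷ e ∷ []))
      where
      b≡-a₂dd : b ≡ - (a₂ * d * d)
      b≡-a₂dd = *-cancelˡ-≢0 (*-≢0 e≢0 e≢0) (combination₂ (+ 1) (- (d * d)) q≡0 a≡a₂ee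
        (solve (a ∷ a₂ ∷ b ∷ d ∷ e ∷ [])))

entrywise : ∀ {x₁₁ x₁₂ x₂₁ x₂₂ y₁₁ y₁₂ y₂₁ y₂₂} →
  x₁₁ ≡ y₁₁ → x₁₂ ≡ y₁₂ → x₂₁ ≡ y₂₁ → x₂₂ ≡ y₂₂ → mat x₁₁ x₁₂ x₂₁ x₂₂ ≡ mat y₁₁ y₁₂ y₂₁ y₂₂
entrywise refl refl refl refl = refl

via-entries : ∀ {X Y x₁₁ x₁₂ x₂₁ x₂₂ y₁₁ y₁₂ y₂₁ y₂₂} →
  X ≡ mat x₁₁ x₁₂ x₂₁ x₂₂ → Y ≡ mat y₁₁ y₁₂ y₂₁ y₂₂ →
  x₁₁ ≡ y₁₁ → x₁₂ ≡ y₁₂ → x₂₁ ≡ y₂₁ → x₂₂ ≡ y₂₂ → X ≡ Y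
via-entries refl refl refl refl refl refl = refl

mat-injective : ∀ {x₁₁ x₁₂ x₂₁ x₂₂ y₁₁ y₁₂ y₂₁ y₂₂} →
  mat x₁₁ x₁₂ x₂₁ x₂₂ ≡ mat y₁₁ y₁₂ y₂₁ y₂₂ → x₁₁ ≡ y₁₁ × x₁₂ ≡ y₁₂ × x₂₁ ≡ y₂₁ × x₂₂ ≡ y₂₂
mat-injective refl = refl , refl , refl , refl

-- The ring solver does not unfold definitions; these lemmas (all refl) expose the entries of
-- scalar matrices, products and a X² + b Y² in a form it can read.

scalar-entries : ∀ t → t · I ≡ mat (t * 1ℤ) (t * 0ℤ) (t * 0ℤ) (t * 1ℤ)
scalar-entries _ = refl

product-entries : ∀ x₁ x₂ x₃ x₄ y₁ y₂ y₃ y₄ → mat x₁ x₂ x₃ x₄ ⊗ mat y₁ y₂ y₃ y₄ ≡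
  mat (x₁ * y₁ + x₂ * y₃) (x₁ * y₂ + x₂ * y₄) (x₃ * y₁ + x₄ * y₃) (x₃ * y₂ + x₄ * y₄)
product-entries _ _ _ _ _ _ _ _ = refl

square-sum-entries : ∀ a b x₁ x₂ x₃ x₄ y₁ y₂ y₃ y₄ →
  (a · (mat x₁ x₂ x₃ x₄ ²)) ⊕ (b · (mat y₁ y₂ y₃ y₄ ²)) ≡
  mat (a * (x₁ * x₁ + x₂ * x₃) + b * (y₁ * y₁ + y₂ * y₃))
      (a * (x₁ * x₂ + x₂ * x₄) + b * (y₁ * y₂ + y₂ * y₄))
      (a * (x₃ * x₁ + x₄ * x₃) + b * (y₃ * y₁ + y₄ * y₃))
      (a * (x₃ * x₂ + x₄ * x₄) + b * (y₃ * y₂ + y₄ * y₄))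
square-sum-entries _ _ _ _ _ _ _ _ _ _ = refl

pencil : ℤ → ℤ → ℤ → ℤ → ℤ → M2
pencil t p n₁ n₂ n₃ = mat t (p * n₁) (p * n₂) (t + p * n₃)

pencil≡scalar+multiple : ∀ t p n₁ n₂ n₃ → pencil t p n₁ n₂ n₃ ≡ (t · I) ⊕ (p · mat 0ℤ n₁ n₂ n₃)
pencil≡scalar+multiple t p n₁ n₂ n₃ = begin
  pencil t p n₁ n₂ n₃
    ≡⟨ entrywise (solve vs) (solve vs) (solve vs) (solve vs) ⟩
  mat (t * 1ℤ + p * 0ℤ) (t * 0ℤ + p * n₁) (t * 0ℤ + p * n₂) (t * 1ℤ + p * n₃)
    ≡⟨⟩
  (t · I) ⊕ (p · mat 0ℤ n₁ n₂ n₃) ∎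
  where
  open ≡-Reasoning
  vs : List ℤ
  vs = t ∷ p ∷ n₁ ∷ n₂ ∷ n₃ ∷ []

pencil≡scalar : ∀ t p n₁ n₂ n₃ → p * n₁ ≡ 0ℤ → p * n₂ ≡ 0ℤ → p * n₃ ≡ 0ℤ →
  pencil t p n₁ n₂ n₃ ≡ t · I
pencil≡scalar t p n₁ n₂ n₃ pn₁≡0 pn₂≡0 pn₃≡0 = via-entries refl (scalar-entries t)
  (solve vs) (combination₁ (+ 1) pn₁≡0 (solve vs)) (combination₁ (+ 1) pn₂≡0 (solve vs))
  (combination₁ (+ 1) pn₃≡0 (solve vs))
  where
  vs : List ℤ
  vs = t ∷ p ∷ n₁ ∷ n₂ ∷ n₃ ∷ []

pencil-neg : ∀ t p n₁ n₂ n₃ → pencil t (- p) (- n₁) (- n₂) (- n₃) ≡ pencil t p n₁ n₂ n₃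
pencil-neg t p n₁ n₂ n₃ = entrywise refl (solve vs) (solve vs) (solve vs)
  where
  vs : List ℤ
  vs = t ∷ p ∷ n₁ ∷ n₂ ∷ n₃ ∷ []

pencil-comm : ∀ t₁ p t₄ q n₁ n₂ n₃ →
  pencil t₁ p n₁ n₂ n₃ ⊗ pencil t₄ q n₁ n₂ n₃ ≡ pencil t₄ q n₁ n₂ n₃ ⊗ pencil t₁ p n₁ n₂ n₃
pencil-comm t₁ p t₄ q n₁ n₂ n₃ = via-entries
  (product-entries t₁ (p * n₁) (p * n₂) (t₁ + p * n₃) t₄ (q * n₁) (q * n₂) (t₄ + q * n₃))
  (product-entries t₄ (q * n₁) (q * n₂) (t₄ + q * n₃) t₁ (p * n₁) (p * n₂) (t₁ + p * n₃))
  (solve vs) (solve vs) (solve vs) (solve vs)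
  where
  vs : List ℤ
  vs = t₁ ∷ p ∷ t₄ ∷ q ∷ n₁ ∷ n₂ ∷ n₃ ∷ []

i*jₖ≡0⇒i≡0∨jₖ≡0 : ∀ i j₁ j₂ j₃ → i * j₁ ≡ 0ℤ → i * j₂ ≡ 0ℤ → i * j₃ ≡ 0ℤ →
  i ≡ 0ℤ ⊎ j₁ ≡ 0ℤ × j₂ ≡ 0ℤ × j₃ ≡ 0ℤ
i*jₖ≡0⇒i≡0∨jₖ≡0 i j₁ j₂ j₃ ij₁≡0 ij₂≡0 ij₃≡0 with i ≟ 0ℤ
... | yes i≡0 = inj₁ i≡0
... | no i≢0 = inj₂ (factor≡0 ij₁≡0 , factor≡0 ij₂≡0 , factor≡0 ij₃≡0)
  where
  factor≡0 : ∀ {j} → i * j ≡ 0ℤ → j ≡ 0ℤ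
  factor≡0 ij≡0 = *-cancelˡ-≢0 i≢0 (trans ij≡0 (sym (*-zeroʳ i)))

pencil-equation⇒ : ∀ a b c t₁ p t₄ q n₁ n₂ n₃ →
  (a · (pencil t₁ p n₁ n₂ n₃ ²)) ⊕ (b · (pencil t₄ q n₁ n₂ n₃ ²)) ≡ c · I →
  a * t₁ * t₁ + b * t₄ * t₄ + (a * p * p + b * q * q) * n₁ * n₂ ≡ c ×
  (+ 2 * (a * p * t₁ + b * q * t₄) + (a * p * p + b * q * q) * n₃ ≡ 0ℤ ⊎
   n₁ ≡ 0ℤ × n₂ ≡ 0ℤ × n₃ ≡ 0ℤ)
pencil-equation⇒ a b c t₁ p t₄ q n₁ n₂ n₃ E =
  let e₁₁ , e₁₂ , e₂₁ , e₂₂ = mat-injective (trans (sym (square-sum-entries a b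
        t₁ (p * n₁) (p * n₂) (t₁ + p * n₃) t₄ (q * n₁) (q * n₂) (t₄ + q * n₃)))
        (trans E (scalar-entries c)))
  in combination₁ (+ 1) e₁₁ (solve vs) ,
     i*jₖ≡0⇒i≡0∨jₖ≡0 (+ 2 * (a * p * t₁ + b * q * t₄) + (a * p * p + b * q * q) * n₃) n₁ n₂ n₃
       (combination₁ (+ 1) e₁₂ (solve vs)) (combination₁ (+ 1) e₂₁ (solve vs))
       (combination₂ (+ 1) (- + 1) e₂₂ e₁₁ (solve vs))
  where
  vs : List ℤ
  vs = a ∷ b ∷ c ∷ t₁ ∷ p ∷ t₄ ∷ q ∷ n₁ ∷ n₂ ∷ n₃ ∷ []

pencil-equation⇐ : ∀ a b c t₁ p t₄ q n₁ n₂ n₃ →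
  a * t₁ * t₁ + b * t₄ * t₄ + (a * p * p + b * q * q) * n₁ * n₂ ≡ c →
  + 2 * (a * p * t₁ + b * q * t₄) + (a * p * p + b * q * q) * n₃ ≡ 0ℤ →
  (a · (pencil t₁ p n₁ n₂ n₃ ²)) ⊕ (b · (pencil t₄ q n₁ n₂ n₃ ²)) ≡ c · I
pencil-equation⇐ a b c t₁ p t₄ q n₁ n₂ n₃ A B = via-entries
  (square-sum-entries a b t₁ (p * n₁) (p * n₂) (t₁ + p * n₃) t₄ (q * n₁) (q * n₂) (t₄ + q * n₃))
  (scalar-entries c)
  (combination₁ (+ 1) A (solve vs)) (combination₁ n₁ B (solve vs))
  (combination₁ n₂ B (solve vs)) (combination₂ (+ 1) n₃ A B (solve vs))
  where
  vs : List ℤ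
  vs = a ∷ b ∷ c ∷ t₁ ∷ p ∷ t₄ ∷ q ∷ n₁ ∷ n₂ ∷ n₃ ∷ []

-- Commuting matrices lie in a common pencil

commute⇒∥ : ∀ x₁ x₂ x₃ x₄ y₁ y₂ y₃ y₄ →
  mat x₁ x₂ x₃ x₄ ⊗ mat y₁ y₂ y₃ y₄ ≡ mat y₁ y₂ y₃ y₄ ⊗ mat x₁ x₂ x₃ x₄ →
  (x₂ , y₂) ∥ (x₃ , y₃) × (x₂ , y₂) ∥ (x₄ - x₁ , y₄ - y₁) × (x₃ , y₃) ∥ (x₄ - x₁ , y₄ - y₁)
commute⇒∥ x₁ x₂ x₃ x₄ y₁ y₂ y₃ y₄ C =
  let c₁₁ , c₁₂ , c₂₁ , _ = mat-injective (trans (sym (product-entries x₁ x₂ x₃ x₄ y₁ y₂ y₃ y₄))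
        (trans C (product-entries y₁ y₂ y₃ y₄ x₁ x₂ x₃ x₄)))
  in cross (combination₁ (- + 1) c₁₁ (solve vs)) ,
     cross (combination₁ (- + 1) c₁₂ (solve vs)) ,
     cross (combination₁ (+ 1) c₂₁ (solve vs))
  where
  vs : List ℤ
  vs = x₁ ∷ x₂ ∷ x₃ ∷ x₄ ∷ y₁ ∷ y₂ ∷ y₃ ∷ y₄ ∷ []

record InCommonPencil (X Y : M2) : Set where
  field
    t₁ t₄ d e n₁ n₂ n₃ : ℤ
    coprime : Coprime d e
    X≡pencil : X ≡ pencil t₁ d n₁ n₂ n₃
    Y≡pencil : Y ≡ pencil t₄ e n₁ n₂ n₃

offsets⇒pencil : ∀ {x₁ x₂ x₃ x₄} d n₁ n₂ n₃ →
  x₂ ≡ d * n₁ → x₃ ≡ d * n₂ → x₄ - x₁ ≡ d * n₃ → mat x₁ x₂ x₃ x₄ ≡ pencil x₁ d n₁ n₂ n₃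
offsets⇒pencil {x₁} {x₂} {x₃} {x₄} d n₁ n₂ n₃ x₂≡ x₃≡ x₄-x₁≡ =
  entrywise refl x₂≡ x₃≡ (combination₁ (+ 1) x₄-x₁≡ (solve (x₁ ∷ x₄ ∷ d ∷ n₃ ∷ [])))

common-pencil-from-pivot : ∀ {x₁ x₂ x₃ x₄ y₁ y₂ y₃ y₄} m l → m ≢ 0ℤ →
  (m , l) ∥ (x₂ , y₂) → (m , l) ∥ (x₃ , y₃) → (m , l) ∥ (x₄ - x₁ , y₄ - y₁) →
  InCommonPencil (mat x₁ x₂ x₃ x₄) (mat y₁ y₂ y₃ y₄)
common-pencil-from-pivot {x₁} {y₁ = y₁} m l m≢0 ∥₂ ∥₃ ∥₄ with primitive-decomposition {m} {l} m≢0
... | d , e , G , G≢0 , d⊥e , m≡dG , l≡eG = assemble (multiple ∥₂) (multiple ∥₃) (multiple ∥₄)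
  where
  d≢0 : d ≢ 0ℤ
  d≢0 d≡0 = m≢0 (trans m≡dG (trans (cong (_* G) d≡0) (*-zeroˡ G)))
  multiple : ∀ {m′ l′} → (m , l) ∥ (m′ , l′) → ∃ λ n → m′ ≡ d * n × l′ ≡ e * n
  multiple ml∥m′l′ = ∥-coprime⇒multiple d≢0 d⊥e (∥-cancel d e G≢0 m≡dG l≡eG ml∥m′l′)
  assemble : ∀ {x₂ x₃ x₄ y₂ y₃ y₄} →
    ∃ (λ n → x₂ ≡ d * n × y₂ ≡ e * n) → ∃ (λ n → x₃ ≡ d * n × y₃ ≡ e * n) →
    ∃ (λ n → x₄ - x₁ ≡ d * n × y₄ - y₁ ≡ e * n) →
    InCommonPencil (mat x₁ x₂ x₃ x₄) (mat y₁ y₂ y₃ y₄)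
  assemble (n₁ , x₂≡ , y₂≡) (n₂ , x₃≡ , y₃≡) (n₃ , x₄≡ , y₄≡) = record
    { t₁ = x₁ ; t₄ = y₁ ; d = d ; e = e ; n₁ = n₁ ; n₂ = n₂ ; n₃ = n₃ ; coprime = d⊥e
    ; X≡pencil = offsets⇒pencil d n₁ n₂ n₃ x₂≡ x₃≡ x₄≡
    ; Y≡pencil = offsets⇒pencil e n₁ n₂ n₃ y₂≡ y₃≡ y₄≡ }

commuting⇒common-pencil : ∀ x₁ x₂ x₃ x₄ y₁ y₂ y₃ y₄ →
  mat x₁ x₂ x₃ x₄ ⊗ mat y₁ y₂ y₃ y₄ ≡ mat y₁ y₂ y₃ y₄ ⊗ mat x₁ x₂ x₃ x₄ →
  InCommonPencil (mat x₁ x₂ x₃ x₄) (mat y₁ y₂ y₃ y₄)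
commuting⇒common-pencil x₁ x₂ x₃ x₄ y₁ y₂ y₃ y₄ C
  with commute⇒∥ x₁ x₂ x₃ x₄ y₁ y₂ y₃ y₄ C | x₂ ≟ 0ℤ | x₃ ≟ 0ℤ | x₄ - x₁ ≟ 0ℤ
... | ∥₂₃ , ∥₂₄ , _ | no x₂≢0 | _ | _ =
  common-pencil-from-pivot x₂ y₂ x₂≢0 ∥-refl ∥₂₃ ∥₂₄
... | ∥₂₃ , _ , ∥₃₄ | yes _ | no x₃≢0 | _ =
  common-pencil-from-pivot x₃ y₃ x₃≢0 (∥-sym ∥₂₃) ∥-refl ∥₃₄
... | _ , ∥₂₄ , ∥₃₄ | yes _ | yes _ | no x₄-x₁≢0 =
  common-pencil-from-pivot (x₄ - x₁) (y₄ - y₁) x₄-x₁≢0 (∥-sym ∥₂₄) (∥-sym ∥₃₄) ∥-refl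
... | _ | yes x₂≡0 | yes x₃≡0 | yes x₄-x₁≡0 = record
  { t₁ = x₁ ; t₄ = y₁ ; d = 0ℤ ; e = 1ℤ ; n₁ = y₂ ; n₂ = y₃ ; n₃ = y₄ - y₁
  ; coprime = coprime-sym (1-coprimeTo 0)
  ; X≡pencil = offsets⇒pencil 0ℤ y₂ y₃ (y₄ - y₁) (trans x₂≡0 (sym (*-zeroˡ y₂)))
      (trans x₃≡0 (sym (*-zeroˡ y₃))) (trans x₄-x₁≡0 (sym (*-zeroˡ (y₄ - y₁))))
  ; Y≡pencil = offsets⇒pencil 1ℤ y₂ y₃ (y₄ - y₁) (sym (*-identityˡ y₂)) (sym (*-identityˡ y₃))
      (sym (*-identityˡ (y₄ - y₁))) }

-- Every case is a solution

IsCommutingSolution : ℤ → ℤ → ℤ → M2 → M2 → Set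
IsCommutingSolution a b c X Y = ((a · (X ²)) ⊕ (b · (Y ²)) ≡ c · I) × (X ⊗ Y ≡ Y ⊗ X)

Case₁ : ℤ → ℤ → ℤ → M2 → M2 → Set
Case₁ a b c X Y = ∃ λ t₁ → ∃ λ t₂ →
  (X ≡ t₁ · I) × (Y ≡ t₂ · I) × (a * t₁ * t₁ + b * t₂ * t₂ ≡ c)

Case₂ : ℤ → ℤ → ℤ → M2 → M2 → Set
Case₂ a b c X Y = ∃ λ t₁ → ∃ λ t₂ → ∃ λ t₃ → ∃ λ t₄ →
  (X ≡ t₁ · I) × (Y ≡ mat t₄ t₂ t₃ (- t₄)) × (a * t₁ * t₁ + b * (t₄ * t₄ + t₂ * t₃) ≡ c)

Case₃ : ℤ → ℤ → ℤ → M2 → M2 → Set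
Case₃ a b c X Y = ∃ λ t₁ → ∃ λ t₂ → ∃ λ t₃ → ∃ λ t₄ → ∃ λ u → ∃ λ v → ∃ λ k →
  let g = gcd (v * a) (u - c) in
  let N = mat (+ 0) t₂ t₃ (- k) in
  (u ≢ c) ×
  (X ≡ (t₁ · I) ⊕ (((u - c) ÷ g) · N)) ×
  (Y ≡ (t₄ · I) ⊕ (((v * a) ÷ g) · N)) ×
  (u * u + v * v * a * b ≡ c * c) ×
  ((a * t₁ * t₁ + b * t₄ * t₄) * (g * g) + + 2 * a * c * t₂ * t₃ * (c - u) ≡ c * (g * g)) ×
  ((g * t₁ + c * k) * (u - c) + v * b * g * t₄ ≡ + 0)

Cases : ℤ → ℤ → ℤ → M2 → M2 → Set
Cases a b c X Y = Case₁ a b c X Y ⊎ Case₂ a b c X Y ⊎ Case₃ a b c X Y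

pencil-solution : ∀ a b c t₁ p t₄ q n₁ n₂ n₃ →
  a * t₁ * t₁ + b * t₄ * t₄ + (a * p * p + b * q * q) * n₁ * n₂ ≡ c →
  + 2 * (a * p * t₁ + b * q * t₄) + (a * p * p + b * q * q) * n₃ ≡ 0ℤ →
  IsCommutingSolution a b c (pencil t₁ p n₁ n₂ n₃) (pencil t₄ q n₁ n₂ n₃)
pencil-solution a b c t₁ p t₄ q n₁ n₂ n₃ A B =
  pencil-equation⇐ a b c t₁ p t₄ q n₁ n₂ n₃ A B , pencil-comm t₁ p t₄ q n₁ n₂ n₃

scalar≡pencil : ∀ t n₁ n₂ n₃ → t · I ≡ pencil t 0ℤ n₁ n₂ n₃
scalar≡pencil t n₁ n₂ n₃ = sym (pencil≡scalar t 0ℤ n₁ n₂ n₃ (*-zeroˡ n₁) (*-zeroˡ n₂) (*-zeroˡ n₃))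

case₁⇒solution : ∀ a b c {X Y} → Case₁ a b c X Y → IsCommutingSolution a b c X Y
case₁⇒solution a b c (t₁ , t₂ , refl , refl , h) =
  subst₂ (IsCommutingSolution a b c) (sym (scalar≡pencil t₁ 0ℤ 0ℤ 0ℤ)) (sym (scalar≡pencil t₂ 0ℤ 0ℤ 0ℤ))
    (pencil-solution a b c t₁ 0ℤ t₂ 0ℤ 0ℤ 0ℤ 0ℤ (combination₁ (+ 1) h (solve vs)) (solve vs))
  where
  vs : List ℤ
  vs = a ∷ b ∷ c ∷ t₁ ∷ t₂ ∷ []

case₂⇒solution : ∀ a b c {X Y} → Case₂ a b c X Y → IsCommutingSolution a b c X Y
case₂⇒solution a b c (t₁ , t₂ , t₃ , t₄ , refl , refl , h) =
  subst₂ (IsCommutingSolution a b c) (sym (scalar≡pencil t₁ t₂ t₃ (- (+ 2 * t₄)))) Y≡pencil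
    (pencil-solution a b c t₁ 0ℤ t₄ 1ℤ t₂ t₃ (- (+ 2 * t₄)) (combination₁ (+ 1) h (solve vs))
      (solve vs))
  where
  vs : List ℤ
  vs = a ∷ b ∷ c ∷ t₁ ∷ t₂ ∷ t₃ ∷ t₄ ∷ []
  Y≡pencil : pencil t₄ 1ℤ t₂ t₃ (- (+ 2 * t₄)) ≡ mat t₄ t₂ t₃ (- t₄)
  Y≡pencil = entrywise refl (*-identityˡ t₂) (*-identityˡ t₃) (solve (t₄ ∷ []))

case₃-conditions⇒pencil-equations : ∀ a b c t₁ t₂ t₃ t₄ u v k g p q → g ≢ 0ℤ →
  g * p ≡ u - c → g * q ≡ v * a → u * u + v * v * a * b ≡ c * c →
  (a * t₁ * t₁ + b * t₄ * t₄) * (g * g) + + 2 * a * c * t₂ * t₃ * (c - u) ≡ c * (g * g) →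
  (g * t₁ + c * k) * (u - c) + v * b * g * t₄ ≡ 0ℤ →
  a * t₁ * t₁ + b * t₄ * t₄ + (a * p * p + b * q * q) * t₂ * t₃ ≡ c ×
  + 2 * (a * p * t₁ + b * q * t₄) + (a * p * p + b * q * q) * (- k) ≡ 0ℤ
case₃-conditions⇒pencil-equations a b c t₁ t₂ t₃ t₄ u v k g p q g≢0 gp≡u-c gq≡va uv E₂ E₃ =
  *-cancelˡ-≢0 g²≢0 (combination₄ (+ 1) (t₂ * t₃ * a) (t₂ * t₃ * a * (g * p + (u - c)))
    (t₂ * t₃ * b * (g * q + v * a)) E₂ uv gp≡u-c gq≡va (solve vs)) ,
  *-cancelˡ-≢0 g²≢0 (combination₄ (+ 2 * a) (- (k * a))
    (+ 2 * g * a * t₁ - k * a * (g * p + (u - c))) (+ 2 * g * b * t₄ - k * b * (g * q + v * a))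
    E₃ uv gp≡u-c gq≡va (solve vs))
  where
  g²≢0 : g * g ≢ 0ℤ
  g²≢0 = *-≢0 g≢0 g≢0
  vs : List ℤ
  vs = a ∷ b ∷ c ∷ t₁ ∷ t₂ ∷ t₃ ∷ t₄ ∷ u ∷ v ∷ k ∷ g ∷ p ∷ q ∷ []

case₃⇒solution : ∀ a b c {X Y} → Case₃ a b c X Y → IsCommutingSolution a b c X Y
case₃⇒solution a b c (t₁ , t₂ , t₃ , t₄ , u , v , k , u≢c , refl , refl , uv , E₂ , E₃) =
  let A , B = case₃-conditions⇒pencil-equations a b c t₁ t₂ t₃ t₄ u v k g p q g≢0
                (÷-exact g≢0 g∣u-c) (÷-exact g≢0 g∣va) uv E₂ E₃
  in subst₂ (IsCommutingSolution a b c) (pencil≡scalar+multiple t₁ p t₂ t₃ (- k))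
       (pencil≡scalar+multiple t₄ q t₂ t₃ (- k)) (pencil-solution a b c t₁ p t₄ q t₂ t₃ (- k) A B)
  where
  g p q : ℤ
  g = gcd (v * a) (u - c)
  p = (u - c) ÷ g
  q = (v * a) ÷ g
  g≢0 : g ≢ 0ℤ
  g≢0 g≡0 = u≢c (i-j≡0⇒i≡j u c (gcd[i,j]≡0⇒j≡0 {v * a} g≡0))
  g∣u-c : g ∣ (u - c)
  g∣u-c = ∣ᵤ⇒∣ (gcd[i,j]∣j (v * a) (u - c))
  g∣va : g ∣ (v * a)
  g∣va = ∣ᵤ⇒∣ (gcd[i,j]∣i (v * a) (u - c))

-- Every solution is one of the cases

-- u = c (b e² − a d²)/s and v = −2cde/s for s = a d² + b e², written without division by means
-- of the two pencil equations.
conic-point : ∀ a b c d e t₁ t₄ n₁ n₂ n₃ →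
  a * t₁ * t₁ + b * t₄ * t₄ + (a * d * d + b * e * e) * n₁ * n₂ ≡ c →
  + 2 * (a * d * t₁ + b * e * t₄) + (a * d * d + b * e * e) * n₃ ≡ 0ℤ →
  ∃₂ λ u v → (a * d * d + b * e * e) * (u - c) ≡ - (+ 2 * a * c * d * d) ×
             (a * d * d + b * e * e) * v ≡ - (+ 2 * c * d * e)
conic-point a b c d e t₁ t₄ n₁ n₂ n₃ A B =
  (b * e * e - a * d * d) * n₁ * n₂ + a * t₁ * t₁ - b * t₄ * t₄ + n₃ * (a * d * t₁ - b * e * t₄) ,
  - (+ 2 * d * e * n₁ * n₂) + t₁ * e * n₃ + + 2 * t₁ * t₄ + d * n₃ * t₄ ,
  combination₂ (a * d * t₁ - b * e * t₄) (b * e * e - a * d * d) B A (solve vs) ,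
  combination₂ (e * t₁ + d * t₄) (- (+ 2 * d * e)) B A (solve vs)
  where
  vs : List ℤ
  vs = a ∷ b ∷ c ∷ d ∷ e ∷ t₁ ∷ t₄ ∷ n₁ ∷ n₂ ∷ n₃ ∷ []

gcd-multiplier⇒case₃ : ∀ a b c t₁ t₄ d e n₁ n₂ n₃ s u v m → a ≢ 0ℤ → d ≢ 0ℤ → m ≢ 0ℤ →
  gcd (v * a) (u - c) ≡ m → u - c ≡ m * d → v * a ≡ m * e → u * u + v * v * a * b ≡ c * c →
  a * t₁ * t₁ + b * t₄ * t₄ + s * n₁ * n₂ ≡ c → + 2 * (a * d * t₁ + b * e * t₄) + s * n₃ ≡ 0ℤ →
  m * s + + 2 * a * c * d ≡ 0ℤ →
  Case₃ a b c (pencil t₁ d n₁ n₂ n₃) (pencil t₄ e n₁ n₂ n₃)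
gcd-multiplier⇒case₃ a b c t₁ t₄ d e n₁ n₂ n₃ s u v m a≢0 d≢0 m≢0 g≡m u-c≡md va≡me uv A B ms+2acd≡0 =
  t₁ , n₁ , n₂ , t₄ , u , v , - n₃ , u≢c , X≡ , Y≡ , uv ,
  subst (λ g → (a * t₁ * t₁ + b * t₄ * t₄) * (g * g) + + 2 * a * c * n₁ * n₂ * (c - u) ≡ c * (g * g))
    (sym g≡m) (combination₃ (m * m) (- (m * n₁ * n₂)) (- (+ 2 * a * c * n₁ * n₂))
                 A ms+2acd≡0 u-c≡md (solve vs)) ,
  subst (λ g → (g * t₁ + c * - n₃) * (u - c) + v * b * g * t₄ ≡ + 0) (sym g≡m)
    (*-cancelˡ-≢0 (*-≢0 {+ 2} (λ ()) a≢0) (combination₄ (m * m) (- (m * n₃))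
       (+ 2 * a * (m * t₁ - c * n₃)) (+ 2 * b * m * t₄) B ms+2acd≡0 u-c≡md va≡me (solve vs)))
  where
  vs : List ℤ
  vs = a ∷ b ∷ c ∷ t₁ ∷ t₄ ∷ d ∷ e ∷ n₁ ∷ n₂ ∷ n₃ ∷ s ∷ u ∷ v ∷ m ∷ []
  u≢c : u ≢ c
  u≢c u≡c = *-≢0 m≢0 d≢0 (trans (sym u-c≡md) (i≡j⇒i-j≡0 u≡c))
  N : ℤ → M2
  N k = mat 0ℤ n₁ n₂ k
  X≡ : pencil t₁ d n₁ n₂ n₃ ≡ (t₁ · I) ⊕ (((u - c) ÷ gcd (v * a) (u - c)) · N (- - n₃))
  X≡ = trans (pencil≡scalar+multiple t₁ d n₁ n₂ n₃)
    (cong₂ (λ p k → (t₁ · I) ⊕ (p · N k)) (sym (trans (cong₂ _÷_ u-c≡md g≡m) (*÷-cancel m≢0)))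
                                          (sym (neg-involutive n₃)))
  Y≡ : pencil t₄ e n₁ n₂ n₃ ≡ (t₄ · I) ⊕ (((v * a) ÷ gcd (v * a) (u - c)) · N (- - n₃))
  Y≡ = trans (pencil≡scalar+multiple t₄ e n₁ n₂ n₃)
    (cong₂ (λ q k → (t₄ · I) ⊕ (q · N k)) (sym (trans (cong₂ _÷_ va≡me g≡m) (*÷-cancel m≢0)))
                                          (sym (neg-involutive n₃)))

multiplier⇒case₃ : ∀ a b c t₁ t₄ d e n₁ n₂ n₃ s u v μ → a ≢ 0ℤ → d ≢ 0ℤ → μ ≢ 0ℤ →
  Coprime d e → u - c ≡ μ * d → v * a ≡ μ * e → u * u + v * v * a * b ≡ c * c →
  a * t₁ * t₁ + b * t₄ * t₄ + s * n₁ * n₂ ≡ c → + 2 * (a * d * t₁ + b * e * t₄) + s * n₃ ≡ 0ℤ →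
  μ * s + + 2 * a * c * d ≡ 0ℤ →
  Case₃ a b c (pencil t₁ d n₁ n₂ n₃) (pencil t₄ e n₁ n₂ n₃)
multiplier⇒case₃ a b c t₁ t₄ d e n₁ n₂ n₃ s u v (+ ℕ.zero) _ _ μ≢0 _ _ _ _ _ _ _ = ⊥-elim (μ≢0 refl)
multiplier⇒case₃ a b c t₁ t₄ d e n₁ n₂ n₃ s u v μ@(+ ℕ.suc n) a≢0 d≢0 μ≢0 d⊥e u-c≡μd va≡μe uv A B
  μs+2acd≡0 = gcd-multiplier⇒case₃ a b c t₁ t₄ d e n₁ n₂ n₃ s u v μ a≢0 d≢0 μ≢0
    (trans (cong₂ gcd va≡μe u-c≡μd) (gcd[m*i,m*j]≡m (ℕ.suc n) e d (coprime-sym d⊥e)))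
    u-c≡μd va≡μe uv A B μs+2acd≡0
multiplier⇒case₃ a b c t₁ t₄ d e n₁ n₂ n₃ s u v -[1+ n ] a≢0 d≢0 _ d⊥e u-c≡μd va≡μe uv A B μs+2acd≡0 =
  negated (+ ℕ.suc n) (λ ()) u-c≡μd va≡μe μs+2acd≡0 (gcd[m*i,m*j]≡m (ℕ.suc n) (- e) (- d)
    (coprime-sym (subst₂ Coprimeℕ (sym (∣-i∣≡∣i∣ d)) (sym (∣-i∣≡∣i∣ e)) d⊥e)))
  where
  vs : List ℤ
  vs = a ∷ b ∷ c ∷ t₁ ∷ t₄ ∷ d ∷ e ∷ n₁ ∷ n₂ ∷ n₃ ∷ s ∷ u ∷ v ∷ []
  -d≢0 : - d ≢ 0ℤ
  -d≢0 -d≡0 = d≢0 (trans (sym (neg-involutive d)) (cong -_ -d≡0))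
  -- The gcd is the multiplier of (u − c, va) along (−d, −e), so the pencil is reparametrised by −N.
  negated : ∀ m → m ≢ 0ℤ → u - c ≡ (- m) * d → v * a ≡ (- m) * e →
    (- m) * s + + 2 * a * c * d ≡ 0ℤ → gcd (m * - e) (m * - d) ≡ m →
    Case₃ a b c (pencil t₁ d n₁ n₂ n₃) (pencil t₄ e n₁ n₂ n₃)
  negated m m≢0 u-c≡-md va≡-me -ms+2acd≡0 g≡m =
    subst₂ (Case₃ a b c) (pencil-neg t₁ d n₁ n₂ n₃) (pencil-neg t₄ e n₁ n₂ n₃)
      (gcd-multiplier⇒case₃ a b c t₁ t₄ (- d) (- e) (- n₁) (- n₂) (- n₃) s u v m a≢0 -d≢0 m≢0
        (trans (cong₂ gcd va≡m[-e] u-c≡m[-d]) g≡m) u-c≡m[-d] va≡m[-e] uv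
        (combination₁ (+ 1) A (solve vs)) (combination₁ (- + 1) B (solve vs))
        (combination₁ (- + 1) -ms+2acd≡0 (solve (m ∷ vs))))
    where
    u-c≡m[-d] : u - c ≡ m * - d
    u-c≡m[-d] = trans u-c≡-md (solve (m ∷ d ∷ []))
    va≡m[-e] : v * a ≡ m * - e
    va≡m[-e] = trans va≡-me (solve (m ∷ e ∷ []))

conic-point⇒case₃ : ∀ a b c t₁ t₄ d e n₁ n₂ n₃ s u v → a ≢ 0ℤ → c ≢ 0ℤ →
  ¬ IsPerfectSquare (- (a * b)) → d ≢ 0ℤ → Coprime d e → a * d * d + b * e * e ≡ s →
  a * t₁ * t₁ + b * t₄ * t₄ + s * n₁ * n₂ ≡ c → + 2 * (a * d * t₁ + b * e * t₄) + s * n₃ ≡ 0ℤ →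
  s * (u - c) ≡ - (+ 2 * a * c * d * d) → s * v ≡ - (+ 2 * c * d * e) →
  Case₃ a b c (pencil t₁ d n₁ n₂ n₃) (pencil t₄ e n₁ n₂ n₃)
conic-point⇒case₃ a b c t₁ t₄ d e n₁ n₂ n₃ s u v a≢0 c≢0 ¬square d≢0 d⊥e s≡ A B su≡ sv≡ =
  from-multiple (∣ᵤ⇒∣ (coprime-divisor d e (u - c) d⊥e (∣⇒∣ᵤ (divides (v * a) e[u-c]≡vad))))
  where
  vs : List ℤ
  vs = a ∷ b ∷ c ∷ d ∷ e ∷ s ∷ u ∷ v ∷ []
  s≢0 : s ≢ 0ℤ
  s≢0 s≡0 = ¬square (quadratic-form≡0⇒square a≢0 d≢0 d⊥e (trans s≡ s≡0))
  e[u-c]≡vad : e * (u - c) ≡ v * a * d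
  e[u-c]≡vad = *-cancelˡ-≢0 s≢0 (combination₂ e (- (a * d)) su≡ sv≡ (solve vs))
  uv : u * u + v * v * a * b ≡ c * c
  uv = *-cancelˡ-≢0 s≢0 (*-cancelˡ-≢0 s≢0 (combination₃ (s * u + s * c - + 2 * a * c * d * d)
    (a * b * (s * v - + 2 * c * d * e)) (+ 4 * a * c * c * d * d) su≡ sv≡ s≡ (solve vs)))
  2acd≢0 : + 2 * a * c * d ≢ 0ℤ
  2acd≢0 = *-≢0 (*-≢0 (*-≢0 {+ 2} (λ ()) a≢0) c≢0) d≢0
  from-multiple : d ∣ (u - c) → Case₃ a b c (pencil t₁ d n₁ n₂ n₃) (pencil t₄ e n₁ n₂ n₃)
  from-multiple (divides μ u-c≡μd) =
    multiplier⇒case₃ a b c t₁ t₄ d e n₁ n₂ n₃ s u v μ a≢0 d≢0 μ≢0 d⊥e u-c≡μd va≡μe uv A B μs+2acd≡0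
    where
    va≡μe : v * a ≡ μ * e
    va≡μe = *-cancelˡ-≢0 d≢0 (combination₂ (- + 1) e e[u-c]≡vad u-c≡μd (solve (μ ∷ vs)))
    μs+2acd≡0 : μ * s + + 2 * a * c * d ≡ 0ℤ
    μs+2acd≡0 = *-cancelˡ-≢0 d≢0 (combination₂ (+ 1) (- s) su≡ u-c≡μd (solve (μ ∷ vs)))
    μ≢0 : μ ≢ 0ℤ
    μ≢0 μ≡0 = 2acd≢0 (combination₂ (+ 1) (- s) μs+2acd≡0 μ≡0 (solve (μ ∷ vs)))

scalar-pencil⇒case₂ : ∀ a b c t₁ t₄ e n₁ n₂ n₃ → b ≢ 0ℤ → Coprime 0ℤ e →
  a * t₁ * t₁ + b * t₄ * t₄ + (a * 0ℤ * 0ℤ + b * e * e) * n₁ * n₂ ≡ c →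
  + 2 * (a * 0ℤ * t₁ + b * e * t₄) + (a * 0ℤ * 0ℤ + b * e * e) * n₃ ≡ 0ℤ →
  Case₂ a b c (pencil t₁ 0ℤ n₁ n₂ n₃) (pencil t₄ e n₁ n₂ n₃)
scalar-pencil⇒case₂ a b c t₁ t₄ e n₁ n₂ n₃ b≢0 0⊥e A B =
  t₁ , e * n₁ , e * n₂ , t₄ , pencil≡scalar t₁ 0ℤ n₁ n₂ n₃ (*-zeroˡ n₁) (*-zeroˡ n₂) (*-zeroˡ n₃) ,
  cong (mat t₄ (e * n₁) (e * n₂)) trace≡0 , combination₁ (+ 1) A (solve vs)
  where
  vs : List ℤ
  vs = a ∷ b ∷ c ∷ t₁ ∷ t₄ ∷ e ∷ n₁ ∷ n₂ ∷ n₃ ∷ []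
  e≢0 : e ≢ 0ℤ
  e≢0 e≡0 = ℕ.0≢1+n (trans (cong ∣_∣ (sym e≡0)) (0-coprimeTo-m⇒m≡1 0⊥e))
  trace≡0 : t₄ + e * n₃ ≡ - t₄
  trace≡0 = *-cancelˡ-≢0 (*-≢0 b≢0 e≢0) (combination₁ (+ 1) B (solve vs))

pencil⇒cases : ∀ a b c t₁ t₄ d e n₁ n₂ n₃ → a ≢ 0ℤ → b ≢ 0ℤ → c ≢ 0ℤ →
  ¬ IsPerfectSquare (- (a * b)) → Coprime d e →
  a * t₁ * t₁ + b * t₄ * t₄ + (a * d * d + b * e * e) * n₁ * n₂ ≡ c →
  + 2 * (a * d * t₁ + b * e * t₄) + (a * d * d + b * e * e) * n₃ ≡ 0ℤ ⊎
    n₁ ≡ 0ℤ × n₂ ≡ 0ℤ × n₃ ≡ 0ℤ →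
  Cases a b c (pencil t₁ d n₁ n₂ n₃) (pencil t₄ e n₁ n₂ n₃)
pencil⇒cases a b c t₁ t₄ d e n₁ n₂ n₃ _ _ _ _ _ A (inj₂ (refl , refl , refl)) =
  inj₁ (t₁ , t₄ , pencil≡scalar t₁ d 0ℤ 0ℤ 0ℤ (*-zeroʳ d) (*-zeroʳ d) (*-zeroʳ d) ,
                  pencil≡scalar t₄ e 0ℤ 0ℤ 0ℤ (*-zeroʳ e) (*-zeroʳ e) (*-zeroʳ e) ,
                  combination₁ (+ 1) A (solve (a ∷ b ∷ c ∷ t₁ ∷ t₄ ∷ d ∷ e ∷ [])))
pencil⇒cases a b c t₁ t₄ d e n₁ n₂ n₃ a≢0 b≢0 c≢0 ¬square d⊥e A (inj₁ B) with d ≟ 0ℤ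
... | yes refl = inj₂ (inj₁ (scalar-pencil⇒case₂ a b c t₁ t₄ e n₁ n₂ n₃ b≢0 d⊥e A B))
... | no d≢0 =
  let u , v , su≡ , sv≡ = conic-point a b c d e t₁ t₄ n₁ n₂ n₃ A B
  in inj₂ (inj₂ (conic-point⇒case₃ a b c t₁ t₄ d e n₁ n₂ n₃ (a * d * d + b * e * e) u v
                   a≢0 c≢0 ¬square d≢0 d⊥e refl A B su≡ sv≡))

common-pencil⇒cases : ∀ a b c {X Y} → a ≢ 0ℤ → b ≢ 0ℤ → c ≢ 0ℤ →
  ¬ IsPerfectSquare (- (a * b)) → InCommonPencil X Y →
  (a · (X ²)) ⊕ (b · (Y ²)) ≡ c · I → Cases a b c X Y
common-pencil⇒cases a b c a≢0 b≢0 c≢0 ¬square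
  record { t₁ = t₁ ; t₄ = t₄ ; d = d ; e = e ; n₁ = n₁ ; n₂ = n₂ ; n₃ = n₃
         ; coprime = d⊥e ; X≡pencil = refl ; Y≡pencil = refl } E =
  let A , B∨N≡0 = pencil-equation⇒ a b c t₁ d t₄ e n₁ n₂ n₃ E
  in pencil⇒cases a b c t₁ t₄ d e n₁ n₂ n₃ a≢0 b≢0 c≢0 ¬square d⊥e A B∨N≡0

solution⇒cases : ∀ a b c → a ≢ 0ℤ → b ≢ 0ℤ → c ≢ 0ℤ → ¬ IsPerfectSquare (- (a * b)) →
  ∀ X Y → IsCommutingSolution a b c X Y → Cases a b c X Y
solution⇒cases a b c a≢0 b≢0 c≢0 ¬square (mat x₁ x₂ x₃ x₄) (mat y₁ y₂ y₃ y₄) (E , C) =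
  common-pencil⇒cases a b c a≢0 b≢0 c≢0 ¬square
    (commuting⇒common-pencil x₁ x₂ x₃ x₄ y₁ y₂ y₃ y₄ C) E

theorem4p1 : (a b c : ℤ) → a ≢ + 0 → b ≢ + 0 → c ≢ + 0 →
    ¬ IsPerfectSquare (- (a * b)) → gcd (gcd a b) c ≡ + 1 →
    (X Y : M2) →
    (((a · (X ²)) ⊕ (b · (Y ²)) ≡ c · I) × (X ⊗ Y ≡ Y ⊗ X)) ⇔
    ((∃ λ t₁ → ∃ λ t₂ →
        (X ≡ t₁ · I) × (Y ≡ t₂ · I) × (a * t₁ * t₁ + b * t₂ * t₂ ≡ c))
     ⊎ (∃ λ t₁ → ∃ λ t₂ → ∃ λ t₃ → ∃ λ t₄ →
        (X ≡ t₁ · I) × (Y ≡ mat t₄ t₂ t₃ (- t₄)) ×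
        (a * t₁ * t₁ + b * (t₄ * t₄ + t₂ * t₃) ≡ c))
     ⊎ (∃ λ t₁ → ∃ λ t₂ → ∃ λ t₃ → ∃ λ t₄ → ∃ λ u → ∃ λ v → ∃ λ k →
        let g = gcd (v * a) (u - c) in
        let N = mat (+ 0) t₂ t₃ (- k) in
        (u ≢ c) ×
        (X ≡ (t₁ · I) ⊕ (((u - c) ÷ g) · N)) ×
        (Y ≡ (t₄ · I) ⊕ (((v * a) ÷ g) · N)) ×
        (u * u + v * v * a * b ≡ c * c) ×
        ((a * t₁ * t₁ + b * t₄ * t₄) * (g * g) + + 2 * a * c * t₂ * t₃ * (c - u)
           ≡ c * (g * g)) ×
        ((g * t₁ + c * k) * (u - c) + v * b * g * t₄ ≡ + 0)))
theorem4p1 a b c a≢0 b≢0 c≢0 ¬square _ X Y = mk⇔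
  (solution⇒cases a b c a≢0 b≢0 c≢0 ¬square X Y)
  [ case₁⇒solution a b c , [ case₂⇒solution a b c , case₃⇒solution a b c ]′ ]′
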